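{- For $n\ge 8$, $c_2(n,P_3)=1$, where $P_3$ is the linear $3$-path, the $3$-graph with vertex set $\{v_1,\dots,v_7\}$ and edges $\{v_1,v_2,v_3\},\{v_3,v_4,v_5\},\{v_5,v_6,v_7\}$.
   Context: For a $3$-graph $G$, $\delta_2(G)$ is the minimum over pairs of vertices of the number of edges containing the pair; $G$ has an $F$-covering if every vertex lies in a copy of $F$; $c_2(n,F)$ is the maximum of $\delta_2(G)$ over $n$-vertex $3$-graphs $G$ with no $F$-covering. -}

module Defs where

open import Data.Nat using (ℕ; _≤_; _≡ᵇ_)
open import Data.Bool using (Bool; true)
open import Data.Fin using (Fin; zero; suc)
open import Data.Fin.Subset using (Subset; ⁅_⁆; _∪_; ∣_∣)
open import Data.Vec using (tabulate)
open import Data.Product using (Σ; ∃; ∃-syntax; _×_)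
open import Function.Definitions using (Injective)
open import Relation.Binary.PropositionalEquality using (_≡_; _≢_)
open import Relation.Nullary using (¬_)

record 3Graph (n : ℕ) : Set where
  field
    isEdge    : Subset n → Bool
    edge-size : ∀ s → isEdge s ≡ true → ∣ s ∣ ≡ 3
open 3Graph public

triple : ∀ {n} → Fin n → Fin n → Fin n → Subset n
triple x y z = ⁅ x ⁆ ∪ ⁅ y ⁆ ∪ ⁅ z ⁆

-- codegree of a pair {x,y}: the number of edges containing both x and y
-- (every such edge is {x,y,z} for a unique z; for z ∈ {x,y} the set
-- triple x y z has < 3 elements and so is never an edge)
codeg : ∀ {n} → 3Graph n → Fin n → Fin n → ℕ
codeg G x y = ∣ tabulate (λ z → isEdge G (triple x y z)) ∣

δ₂≡ : ∀ {n} → 3Graph n → ℕ → Set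
δ₂≡ G k = (∀ x y → x ≢ y → k ≤ codeg G x y)
        × (∃[ x ] ∃[ y ] (x ≢ y × codeg G x y ≡ k))

record P₃Copy {n : ℕ} (G : 3Graph n) : Set where
  field
    f   : Fin 7 → Fin n
    inj : Injective _≡_ _≡_ f
    e₁  : isEdge G (triple (f zero) (f (suc zero)) (f (suc (suc zero)))) ≡ true
    e₂  : isEdge G (triple (f (suc (suc zero))) (f (suc (suc (suc zero))))
                           (f (suc (suc (suc (suc zero)))))) ≡ true
    e₃  : isEdge G (triple (f (suc (suc (suc (suc zero)))))
                           (f (suc (suc (suc (suc (suc zero))))))
                           (f (suc (suc (suc (suc (suc (suc zero)))))))) ≡ true
open P₃Copy public

HasP₃Covering : ∀ {n} → 3Graph n → Set
HasP₃Covering {n} G = ∀ (v : Fin n) → Σ (P₃Copy G) (λ c → ∃[ i ] f c i ≡ v)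

c₂P₃≡ : ℕ → ℕ → Set
c₂P₃≡ n m = (Σ (3Graph n) (λ G → δ₂≡ G m × ¬ HasP₃Covering G))
          × (∀ (G : 3Graph n) (k : ℕ) → δ₂≡ G k → ¬ HasP₃Covering G → k ≤ m)

-- Lower bound: in the star 3-graph (all triples through vertex 0) every pair has
-- codegree at least 1 and the pair {1, 2} has codegree exactly 1, but the star
-- contains no P₃ at all, since the two end edges of a P₃ would both contain 0.
--
-- Upper bound: suppose every pair has codegree at least 2 and n ≥ 7, and fix v.
-- The link of v contains two disjoint pairs, i.e. a bowtie {v,x,a}, {v,c,d}. For
-- two vertices w₁, w₂ outside the bowtie pick an edge w₁w₂z with z ≠ v. If z is a
-- leaf x, a, c or d, this edge extends the bowtie to a P₃. Otherwise w₁w₂z is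
-- disjoint from the bowtie; pick an edge x w₁ z′ with z′ ≠ a. If z′ ∈ {v, c, d},
-- the edges w₁w₂z, w₁xz′ and one edge of the bowtie form a P₃ through v; if z′
-- lies outside the bowtie, the edge w₁z′x extends the bowtie to a P₃.
module Submission where

open import Algebra.Bundles using (CommutativeMonoid)
import Algebra.Properties.CommutativeSemigroup as CommutativeSemigroupProperties
open import Data.Bool using (Bool; true; _∧_)
open import Data.Bool.Properties using (T-≡)
open import Data.Fin using (Fin; zero; suc; _≟_; #_)
open import Data.Fin.Properties using (any?; pigeonhole; <⇒≢; suc-injective)
open import Data.Fin.Subset
  using (Subset; inside; outside; ⁅_⁆; _∪_; ∣_∣; _∈_; _∉_; Nonempty)
open import Data.Fin.Subset.Properties
  using ( ∪-commutativeMonoid; ∪-idem; ∪-identityˡ; ∣⁅x⁆∣≡1; x∈⁅x⁆; x∈⁅y⁆⇒x≡y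
        ; x≢y⇒x∉⁅y⁆; x∈p∪q⁺; x∈p∪q⁻; drop-not-there; x∈p⇒∣p-x∣<∣p∣ )
open import Data.List using (List; []; _∷_; length; lookup)
import Data.List.Membership.DecPropositional as DecMembership
open import Data.List.Membership.Propositional using () renaming (_∈_ to _∈ₗ_)
open import Data.List.Membership.Propositional.Properties using (∈-lookup)
open import Data.List.Relation.Unary.All as All using (All; []; _∷_)
open import Data.List.Relation.Unary.All.Properties using (¬Any⇒All¬)
open import Data.List.Relation.Unary.Any using (here; there; index)
open import Data.List.Relation.Unary.Any.Properties using (lookup-index)
open import Data.List.Relation.Unary.Unique.Propositional using (Unique; []; _∷_)
open import Data.Nat using (ℕ; suc; _+_; _≤_; _<_; _≡ᵇ_; z≤n; s≤s; _≤?_)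
open import Data.Nat.Properties
  using (≤-trans; +-suc; +-monoʳ-≤; n≤1+n; m≤m+n; ≰⇒>; ≡ᵇ⇒≡; ≡⇒≡ᵇ; module ≤-Reasoning)
import Data.Nat.Properties as ℕ
open import Data.Product as Product using (Σ; ∃-syntax; _×_; _,_; proj₁)
open import Data.Sum as Sum using (_⊎_; inj₁; inj₂; [_,_]′)
open import Data.Vec using (Vec; tabulate; []; _∷_; here; there) renaming (lookup to vlookup)
open import Data.Vec.Properties using (lookup∘tabulate; []=⇒lookup; lookup⇒[]=)
open import Data.Vec.Relation.Unary.AllPairs using (allPairs?)
import Data.Vec.Relation.Unary.Unique.Propositional.Properties as VecUnique
open import Function using (_∘_; case_of_)
open import Function.Bundles using (Equivalence)
open import Function.Definitions using (Injective)
open import Relation.Binary.PropositionalEquality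
  using (_≡_; _≢_; refl; sym; trans; cong; cong₂; subst; ≢-sym; module ≡-Reasoning)
open import Relation.Nullary using (¬_; yes; no; contradiction; ¬?)
open import Relation.Nullary.Decidable using (True; toWitness; decidable-stable)

open import Defs

lookup-injective : ∀ {A : Set} {xs : List A} → Unique xs → Injective _≡_ _≡_ (lookup xs)
lookup-injective {xs = _ ∷ _} _ {zero} {zero} _ = refl
lookup-injective (x∉xs ∷ _) {zero} {suc j} x≡xⱼ =
  contradiction x≡xⱼ (All.lookup x∉xs (∈-lookup j))
lookup-injective (x∉xs ∷ _) {suc i} {zero} xᵢ≡x =
  contradiction (sym xᵢ≡x) (All.lookup x∉xs (∈-lookup i))
lookup-injective (_ ∷ xs!) {suc i} {suc j} xᵢ≡xⱼ = cong suc (lookup-injective xs! xᵢ≡xⱼ)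

module _ {n : ℕ} where
  open DecMembership (_≟_ {n}) using (_∈?_)

  short-list-misses-some : (xs : List (Fin n)) → length xs < n → ¬ (∀ y → y ∈ₗ xs)
  short-list-misses-some xs |xs|<n every-y∈xs
    with pigeonhole |xs|<n (λ y → index (every-y∈xs y))
  ... | i , j , i<j , same-index = <⇒≢ i<j (begin
    i                               ≡⟨ lookup-index (every-y∈xs i) ⟩
    lookup xs (index (every-y∈xs i)) ≡⟨ cong (lookup xs) same-index ⟩
    lookup xs (index (every-y∈xs j)) ≡⟨ sym (lookup-index (every-y∈xs j)) ⟩
    j                               ∎)
    where open ≡-Reasoning

  fresh : (xs : List (Fin n)) → length xs < n → ∃[ y ] All (y ≢_) xs
  fresh xs |xs|<n with any? (λ y → ¬? (y ∈? xs))
  ... | yes (y , y∉xs) = y , ¬Any⇒All¬ xs y∉xs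
  ... | no ¬fresh = contradiction
    (λ y → decidable-stable (y ∈? xs) (λ y∉xs → ¬fresh (y , y∉xs)))
    (short-list-misses-some xs |xs|<n)

∣p∪q∣≤∣p∣+∣q∣ : ∀ {m} (p q : Subset m) → ∣ p ∪ q ∣ ≤ ∣ p ∣ + ∣ q ∣
∣p∪q∣≤∣p∣+∣q∣ [] [] = z≤n
∣p∪q∣≤∣p∣+∣q∣ (outside ∷ p) (outside ∷ q) = ∣p∪q∣≤∣p∣+∣q∣ p q
∣p∪q∣≤∣p∣+∣q∣ (outside ∷ p) (inside ∷ q) rewrite +-suc ∣ p ∣ ∣ q ∣ = s≤s (∣p∪q∣≤∣p∣+∣q∣ p q)
∣p∪q∣≤∣p∣+∣q∣ (inside ∷ p) (outside ∷ q) = s≤s (∣p∪q∣≤∣p∣+∣q∣ p q)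
∣p∪q∣≤∣p∣+∣q∣ (inside ∷ p) (inside ∷ q) =
  s≤s (≤-trans (∣p∪q∣≤∣p∣+∣q∣ p q) (+-monoʳ-≤ ∣ p ∣ (n≤1+n ∣ q ∣)))

∣⁅x⁆∪p∣≡1+∣p∣ : ∀ {m} {x : Fin m} {p : Subset m} → x ∉ p → ∣ ⁅ x ⁆ ∪ p ∣ ≡ suc ∣ p ∣
∣⁅x⁆∪p∣≡1+∣p∣ {x = zero} {inside ∷ p} x∉p = contradiction here x∉p
∣⁅x⁆∪p∣≡1+∣p∣ {x = zero} {outside ∷ p} _ = cong (suc ∘ ∣_∣) (∪-identityˡ p)
∣⁅x⁆∪p∣≡1+∣p∣ {x = suc x} {outside ∷ p} x∉p = ∣⁅x⁆∪p∣≡1+∣p∣ (drop-not-there x∉p)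
∣⁅x⁆∪p∣≡1+∣p∣ {x = suc x} {inside ∷ p} x∉p = cong suc (∣⁅x⁆∪p∣≡1+∣p∣ (drop-not-there x∉p))

x∈p⇒1≤∣p∣ : ∀ {m} {x : Fin m} {p : Subset m} → x ∈ p → 1 ≤ ∣ p ∣
x∈p⇒1≤∣p∣ x∈p = ≤-trans (s≤s z≤n) (x∈p⇒∣p-x∣<∣p∣ x∈p)

1≤∣p∣⇒Nonempty : ∀ {m} (p : Subset m) → 1 ≤ ∣ p ∣ → Nonempty p
1≤∣p∣⇒Nonempty (inside ∷ p) _ = zero , here
1≤∣p∣⇒Nonempty (outside ∷ p) 1≤∣p∣ = Product.map suc there (1≤∣p∣⇒Nonempty p 1≤∣p∣)

2≤∣p∣⇒∃∈p≢ : ∀ {m} (p : Subset m) (u : Fin m) → 2 ≤ ∣ p ∣ → ∃[ z ] z ∈ p × z ≢ u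
2≤∣p∣⇒∃∈p≢ (inside ∷ p) (suc u) _ = zero , here , λ ()
2≤∣p∣⇒∃∈p≢ (inside ∷ p) zero (s≤s 1≤∣p∣) =
  Product.map suc (λ z∈p → there z∈p , λ ()) (1≤∣p∣⇒Nonempty p 1≤∣p∣)
2≤∣p∣⇒∃∈p≢ (outside ∷ p) zero 2≤∣p∣ =
  Product.map suc (λ z∈p → there z∈p , λ ()) (1≤∣p∣⇒Nonempty p (≤-trans (s≤s z≤n) 2≤∣p∣))
2≤∣p∣⇒∃∈p≢ (outside ∷ p) (suc u) 2≤∣p∣ =
  Product.map suc (Product.map there (_∘ suc-injective)) (2≤∣p∣⇒∃∈p≢ p u 2≤∣p∣)

module _ {m : ℕ} {x a b c : Fin m} where

  ∈-triple⁻ : x ∈ triple a b c → x ≡ a ⊎ x ≡ b ⊎ x ≡ c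
  ∈-triple⁻ =
    Sum.map (x∈⁅y⁆⇒x≡y a) (Sum.map (x∈⁅y⁆⇒x≡y b) (x∈⁅y⁆⇒x≡y c) ∘ x∈p∪q⁻ ⁅ b ⁆ ⁅ c ⁆)
    ∘ x∈p∪q⁻ ⁅ a ⁆ _

  ∈-triple⁺ : x ≡ a ⊎ x ≡ b ⊎ x ≡ c → x ∈ triple a b c
  ∈-triple⁺ (inj₁ refl) = x∈p∪q⁺ (inj₁ (x∈⁅x⁆ a))
  ∈-triple⁺ (inj₂ (inj₁ refl)) = x∈p∪q⁺ (inj₂ (x∈p∪q⁺ (inj₁ (x∈⁅x⁆ b))))
  ∈-triple⁺ (inj₂ (inj₂ refl)) = x∈p∪q⁺ (inj₂ (x∈p∪q⁺ (inj₂ (x∈⁅x⁆ c))))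

∣triple∣≡3 : ∀ {m} {a b c : Fin m} → a ≢ b → a ≢ c → b ≢ c → ∣ triple a b c ∣ ≡ 3
∣triple∣≡3 {a = a} {b} {c} a≢b a≢c b≢c = begin
  ∣ ⁅ a ⁆ ∪ ⁅ b ⁆ ∪ ⁅ c ⁆ ∣ ≡⟨ ∣⁅x⁆∪p∣≡1+∣p∣ a∉⁅b⁆∪⁅c⁆ ⟩
  suc ∣ ⁅ b ⁆ ∪ ⁅ c ⁆ ∣     ≡⟨ cong suc (∣⁅x⁆∪p∣≡1+∣p∣ (x≢y⇒x∉⁅y⁆ b≢c)) ⟩
  2 + ∣ ⁅ c ⁆ ∣             ≡⟨ cong (2 +_) (∣⁅x⁆∣≡1 c) ⟩
  3                         ∎
  where
  open ≡-Reasoning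
  a∉⁅b⁆∪⁅c⁆ : a ∉ ⁅ b ⁆ ∪ ⁅ c ⁆
  a∉⁅b⁆∪⁅c⁆ = [ x≢y⇒x∉⁅y⁆ a≢b , x≢y⇒x∉⁅y⁆ a≢c ]′ ∘ x∈p∪q⁻ ⁅ b ⁆ ⁅ c ⁆

∣triple-a-b-b∣≤2 : ∀ {m} (a b : Fin m) → ∣ triple a b b ∣ ≤ 2
∣triple-a-b-b∣≤2 a b = begin
  ∣ ⁅ a ⁆ ∪ ⁅ b ⁆ ∪ ⁅ b ⁆ ∣ ≡⟨ cong (λ s → ∣ ⁅ a ⁆ ∪ s ∣) (∪-idem ⁅ b ⁆) ⟩
  ∣ ⁅ a ⁆ ∪ ⁅ b ⁆ ∣        ≤⟨ ∣p∪q∣≤∣p∣+∣q∣ ⁅ a ⁆ ⁅ b ⁆ ⟩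
  ∣ ⁅ a ⁆ ∣ + ∣ ⁅ b ⁆ ∣     ≡⟨ cong₂ _+_ (∣⁅x⁆∣≡1 a) (∣⁅x⁆∣≡1 b) ⟩
  2                        ∎
  where open ≤-Reasoning

module Hypergraph {n : ℕ} (G : 3Graph n) where
  open CommutativeSemigroupProperties
    (CommutativeMonoid.commutativeSemigroup (∪-commutativeMonoid n))

  Edge : Fin n → Fin n → Fin n → Set
  Edge a b c = isEdge G (triple a b c) ≡ true

  common-neighbours : Fin n → Fin n → Subset n
  common-neighbours a b = tabulate (λ c → isEdge G (triple a b c))

  Covered : Fin n → Set
  Covered v = Σ (P₃Copy G) λ copy → ∃[ i ] f copy i ≡ v

  record Bowtie (v : Fin n) : Set where
    field
      x a c d  : Fin n
      distinct : Unique (d ∷ c ∷ a ∷ x ∷ v ∷ [])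
      left     : Edge v x a
      right    : Edge v c d

  Edge-swap : ∀ {a b c} → Edge a b c → Edge b a c
  Edge-swap {a} {b} {c} = subst (λ s → isEdge G s ≡ true) (x∙yz≈y∙xz ⁅ a ⁆ ⁅ b ⁆ ⁅ c ⁆)

  Edge-rotate : ∀ {a b c} → Edge a b c → Edge b c a
  Edge-rotate {a} {b} {c} = subst (λ s → isEdge G s ≡ true) (x∙yz≈y∙zx ⁅ a ⁆ ⁅ b ⁆ ⁅ c ⁆)

  Edge-third≢second : ∀ {a b c} → Edge a b c → c ≢ b
  Edge-third≢second {a} {b} abb refl =
    contradiction (subst (_≤ 2) (edge-size G _ abb) (∣triple-a-b-b∣≤2 a b))
                  λ { (s≤s (s≤s ())) }

  Edge-third≢first : ∀ {a b c} → Edge a b c → c ≢ a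
  Edge-third≢first = Edge-third≢second ∘ Edge-swap

  ∈-common-neighbours⁻ : ∀ {a b c} → c ∈ common-neighbours a b → Edge a b c
  ∈-common-neighbours⁻ {c = c} c∈N = trans (sym (lookup∘tabulate _ c)) ([]=⇒lookup c∈N)

  ∈-common-neighbours⁺ : ∀ {a b c} → Edge a b c → c ∈ common-neighbours a b
  ∈-common-neighbours⁺ {c = c} abc = lookup⇒[]= c _ (trans (lookup∘tabulate _ c) abc)

  Edge⇒1≤codeg : ∀ {a b c} → Edge a b c → 1 ≤ codeg G a b
  Edge⇒1≤codeg = x∈p⇒1≤∣p∣ ∘ ∈-common-neighbours⁺

  2≤codeg⇒Edge-avoiding : ∀ {a b} → 2 ≤ codeg G a b → ∀ u → ∃[ c ] Edge a b c × c ≢ u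
  2≤codeg⇒Edge-avoiding {a} {b} 2≤codeg u =
    Product.map₂ (Product.map₁ ∈-common-neighbours⁻)
                 (2≤∣p∣⇒∃∈p≢ (common-neighbours a b) u 2≤codeg)

  path : ∀ {vs} → Unique vs → (is : Vec (Fin (length vs)) 7) →
         {True (allPairs? (λ i j → ¬? (i ≟ j)) is)} →
         let p = lookup vs ∘ vlookup is in
         Edge (p (# 0)) (p (# 1)) (p (# 2)) →
         Edge (p (# 2)) (p (# 3)) (p (# 4)) →
         Edge (p (# 4)) (p (# 5)) (p (# 6)) →
         ∀ k → Covered (p k)
  path {vs} vs! is {is!} e₁ e₂ e₃ k = copy , k , refl
    where
    copy : P₃Copy G
    copy = record
      { f   = lookup vs ∘ vlookup is
      ; inj = λ same → VecUnique.lookup-injective (toWitness is!) _ _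
                         (lookup-injective vs! same)
      ; e₁  = e₁
      ; e₂  = e₂
      ; e₃  = e₃
      }

  P₃-end-edges-disjoint : (copy : P₃Copy G) → ∀ {x} →
    x ∈ triple (f copy (# 0)) (f copy (# 1)) (f copy (# 2)) →
    x ∉ triple (f copy (# 4)) (f copy (# 5)) (f copy (# 6))
  P₃-end-edges-disjoint copy x∈e₁ x∈e₃ with ∈-triple⁻ x∈e₁ | ∈-triple⁻ x∈e₃
  ... | inj₁ refl         | inj₁ same         = case inj copy same of λ ()
  ... | inj₁ refl         | inj₂ (inj₁ same) = case inj copy same of λ ()
  ... | inj₁ refl         | inj₂ (inj₂ same) = case inj copy same of λ ()
  ... | inj₂ (inj₁ refl) | inj₁ same         = case inj copy same of λ ()
  ... | inj₂ (inj₁ refl) | inj₂ (inj₁ same) = case inj copy same of λ ()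
  ... | inj₂ (inj₁ refl) | inj₂ (inj₂ same) = case inj copy same of λ ()
  ... | inj₂ (inj₂ refl) | inj₁ same         = case inj copy same of λ ()
  ... | inj₂ (inj₂ refl) | inj₂ (inj₁ same) = case inj copy same of λ ()
  ... | inj₂ (inj₂ refl) | inj₂ (inj₂ same) = case inj copy same of λ ()

module Covering {n : ℕ} (G : 3Graph n) (7≤n : 7 ≤ n)
                (2≤codeg : ∀ x y → x ≢ y → 2 ≤ codeg G x y) where

  open DecMembership (_≟_ {n}) using (_∈?_)
  open Hypergraph G

  fresh-vertex : (xs : List (Fin n)) → {True (length xs ≤? 6)} → ∃[ y ] All (y ≢_) xs
  fresh-vertex xs {|xs|≤6} = fresh xs (≤-trans (s≤s (toWitness |xs|≤6)) 7≤n)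

  edge-avoiding : ∀ {a b} → a ≢ b → ∀ u → ∃[ c ] Edge a b c × c ≢ u
  edge-avoiding a≢b = 2≤codeg⇒Edge-avoiding (2≤codeg _ _ a≢b)

  -- An edge v y₃ t with t ≠ z pairs with v y₁ z, unless t = y₁;
  -- then v y₃ y₁ pairs with v y₂ z.
  bowtie-from-two-edges : ∀ {v y₁ y₂ z} → Unique (y₂ ∷ z ∷ y₁ ∷ v ∷ []) →
                          Edge v y₁ z → Edge v y₂ z → Bowtie v
  bowtie-from-two-edges {v} {y₁} {y₂} {z}
    ((y₂≢z ∷ y₂≢y₁ ∷ y₂≢v ∷ []) ∷ Z!@((z≢y₁ ∷ z≢v ∷ []) ∷ (y₁≢v ∷ []) ∷ _)) vy₁z vy₂z
    with fresh-vertex (y₂ ∷ z ∷ y₁ ∷ v ∷ [])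
  ... | y₃ , y₃≢y₂ ∷ y₃∉Z@(y₃≢z ∷ y₃≢y₁ ∷ y₃≢v ∷ []) with edge-avoiding (≢-sym y₃≢v) z
  ... | t , vy₃t , t≢z with t ≟ y₁
  ... | no t≢y₁ = record
    { distinct = (Edge-third≢second vy₃t ∷ t≢z ∷ t≢y₁ ∷ Edge-third≢first vy₃t ∷ [])
                 ∷ y₃∉Z ∷ Z!
    ; left = vy₁z ; right = vy₃t }
  ... | yes refl = record
    { distinct = (≢-sym y₂≢z ∷ z≢y₁ ∷ ≢-sym y₃≢z ∷ z≢v ∷ [])
                 ∷ (y₂≢y₁ ∷ ≢-sym y₃≢y₂ ∷ y₂≢v ∷ [])
                 ∷ (≢-sym y₃≢y₁ ∷ y₁≢v ∷ []) ∷ (y₃≢v ∷ []) ∷ [] ∷ []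
    ; left = vy₃t ; right = vy₂z }

  bowtie-from-edge : ∀ {v y₁ z} → Unique (z ∷ y₁ ∷ v ∷ []) → Edge v y₁ z → Bowtie v
  bowtie-from-edge {v} {y₁} {z} Z! vy₁z with fresh-vertex (z ∷ y₁ ∷ v ∷ [])
  ... | y₂ , y₂∉Z@(_ ∷ _ ∷ y₂≢v ∷ []) with edge-avoiding (≢-sym y₂≢v) y₁
  ... | u , vy₂u , u≢y₁ with u ≟ z
  ... | no u≢z = record
    { distinct = (Edge-third≢second vy₂u ∷ u≢z ∷ u≢y₁ ∷ Edge-third≢first vy₂u ∷ [])
                 ∷ y₂∉Z ∷ Z!
    ; left = vy₁z ; right = vy₂u }
  ... | yes refl = bowtie-from-two-edges (y₂∉Z ∷ Z!) vy₁z vy₂u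

  bowtie : ∀ v → Bowtie v
  bowtie v with fresh-vertex (v ∷ [])
  ... | y₁ , y₁∉V@(y₁≢v ∷ []) with edge-avoiding (≢-sym y₁≢v) v
  ... | z , vy₁z , _ = bowtie-from-edge
    ((Edge-third≢second vy₁z ∷ Edge-third≢first vy₁z ∷ []) ∷ y₁∉V ∷ [] ∷ []) vy₁z

  module _ {v : Fin n} (B : Bowtie v) where
    open Bowtie B

    S : List (Fin n)
    S = d ∷ c ∷ a ∷ x ∷ v ∷ []

    covered-by-pendant : ∀ {p q} → Unique (q ∷ p ∷ S) → Edge p q x → Covered v
    covered-by-pendant Q! pqx = path Q! (# 1 ∷ # 0 ∷ # 5 ∷ # 4 ∷ # 6 ∷ # 3 ∷ # 2 ∷ [])
                                     pqx (Edge-rotate left) right (# 4)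

    covered-by-disjoint-edge : ∀ {w₁ w₂ z} → Unique (z ∷ w₂ ∷ w₁ ∷ S) → Edge w₁ w₂ z →
                               Covered v
    covered-by-disjoint-edge Z!@(_ ∷ _ ∷ w₁!@((_ ∷ _ ∷ _ ∷ w₁≢x ∷ _) ∷ _)) w₁w₂z
      with edge-avoiding (≢-sym w₁≢x) a
    ... | z′ , xw₁z′ , z′≢a with z′ ∈? S
    ... | yes (here refl) =
      path Z! (# 1 ∷ # 0 ∷ # 2 ∷ # 6 ∷ # 3 ∷ # 4 ∷ # 7 ∷ [])
           (Edge-rotate w₁w₂z) (Edge-swap xw₁z′) (Edge-swap (Edge-rotate right)) (# 6)
    ... | yes (there (here refl)) =
      path Z! (# 1 ∷ # 0 ∷ # 2 ∷ # 6 ∷ # 4 ∷ # 3 ∷ # 7 ∷ [])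
           (Edge-rotate w₁w₂z) (Edge-swap xw₁z′) (Edge-rotate right) (# 6)
    ... | yes (there (there (here z′≡a))) = contradiction z′≡a z′≢a
    ... | yes (there (there (there (here z′≡x)))) = contradiction z′≡x (Edge-third≢first xw₁z′)
    ... | yes (there (there (there (there (here refl))))) =
      path Z! (# 1 ∷ # 0 ∷ # 2 ∷ # 6 ∷ # 7 ∷ # 4 ∷ # 3 ∷ [])
           (Edge-rotate w₁w₂z) (Edge-swap xw₁z′) right (# 4)
    ... | no z′∉S = covered-by-pendant
      ((Edge-third≢second xw₁z′ ∷ ¬Any⇒All¬ S z′∉S) ∷ w₁!) (Edge-rotate xw₁z′)

    covered-by-outer-edge : ∀ {w₁ w₂ z} → Unique (w₂ ∷ w₁ ∷ S) → Edge w₁ w₂ z → z ≢ v →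
                            Covered v
    covered-by-outer-edge {z = z} W! w₁w₂z z≢v with z ∈? S
    ... | yes (here refl) =
      path W! (# 1 ∷ # 0 ∷ # 2 ∷ # 3 ∷ # 6 ∷ # 5 ∷ # 4 ∷ [])
           w₁w₂z (Edge-swap (Edge-rotate right)) left (# 4)
    ... | yes (there (here refl)) =
      path W! (# 1 ∷ # 0 ∷ # 3 ∷ # 2 ∷ # 6 ∷ # 5 ∷ # 4 ∷ [])
           w₁w₂z (Edge-rotate right) left (# 4)
    ... | yes (there (there (here refl))) =
      path W! (# 1 ∷ # 0 ∷ # 4 ∷ # 5 ∷ # 6 ∷ # 3 ∷ # 2 ∷ [])
           w₁w₂z (Edge-swap (Edge-rotate left)) right (# 4)
    ... | yes (there (there (there (here refl)))) = covered-by-pendant W! w₁w₂z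
    ... | yes (there (there (there (there (here z≡v))))) = contradiction z≡v z≢v
    ... | no z∉S = covered-by-disjoint-edge
      ((Edge-third≢second w₁w₂z ∷ Edge-third≢first w₁w₂z ∷ ¬Any⇒All¬ S z∉S) ∷ W!) w₁w₂z

    covered-by-bowtie : Covered v
    covered-by-bowtie with fresh-vertex S
    ... | w₁ , w₁∉S with fresh-vertex (w₁ ∷ S)
    ... | w₂ , w₂∉ with edge-avoiding (≢-sym (All.head w₂∉)) v
    ... | z , w₁w₂z , z≢v = covered-by-outer-edge (w₂∉ ∷ w₁∉S ∷ distinct) w₁w₂z z≢v

  covered : HasP₃Covering G
  covered v = covered-by-bowtie (bowtie v)

codeg-bound : ∀ {n} → 7 ≤ n → (G : 3Graph n) (k : ℕ) → δ₂≡ G k → ¬ HasP₃Covering G → k ≤ 1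
codeg-bound 7≤n G k (k≤codeg , _) uncovered with k ≤? 1
... | yes k≤1 = k≤1
... | no k≰1 = contradiction
  (Covering.covered G 7≤n (λ x y x≢y → ≤-trans (≰⇒> k≰1) (k≤codeg x y x≢y))) uncovered

star-edge : ∀ {m} → Subset (suc m) → Bool
star-edge (s ∷ p) = s ∧ (∣ p ∣ ≡ᵇ 2)

star : ∀ m → 3Graph (suc m)
star m = record { isEdge = star-edge ; edge-size = star-edge-size }
  where
  star-edge-size : ∀ s → star-edge s ≡ true → ∣ s ∣ ≡ 3
  star-edge-size (inside ∷ p) e = cong suc (≡ᵇ⇒≡ ∣ p ∣ 2 (Equivalence.from T-≡ e))

star-edge⇒0∈ : ∀ {m} {s : Subset (suc m)} → star-edge s ≡ true → zero ∈ s
star-edge⇒0∈ {s = inside ∷ _} _ = here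

star-edge-intro : ∀ {m} {s : Subset (suc m)} → zero ∈ s → ∣ s ∣ ≡ 3 → star-edge s ≡ true
star-edge-intro {s = inside ∷ p} here ∣s∣≡3 =
  Equivalence.to T-≡ (≡⇒≡ᵇ ∣ p ∣ 2 (ℕ.suc-injective ∣s∣≡3))

∣tabulate-outside∣≡0 : ∀ m → ∣ tabulate {n = m} (λ _ → outside) ∣ ≡ 0
∣tabulate-outside∣≡0 0 = refl
∣tabulate-outside∣≡0 (suc m) = ∣tabulate-outside∣≡0 m

star-P₃-free : ∀ {m} → ¬ P₃Copy (star m)
star-P₃-free copy =
  P₃-end-edges-disjoint copy (star-edge⇒0∈ (e₁ copy)) (star-edge⇒0∈ (e₃ copy))
  where open Hypergraph (star _)

module _ {m : ℕ} where
  open Hypergraph (star (2 + m))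

  star-Edge : ∀ {a b c} → zero ≡ a ⊎ zero ≡ b ⊎ zero ≡ c → a ≢ b → a ≢ c → b ≢ c →
              Edge a b c
  star-Edge 0∈abc a≢b a≢c b≢c = star-edge-intro (∈-triple⁺ 0∈abc) (∣triple∣≡3 a≢b a≢c b≢c)

  other-than-zero-and : (y : Fin (3 + m)) → ∃[ z ] z ≢ zero × z ≢ y
  other-than-zero-and zero = # 1 , (λ ()) , (λ ())
  other-than-zero-and (suc zero) = # 2 , (λ ()) , (λ ())
  other-than-zero-and (suc (suc _)) = # 1 , (λ ()) , (λ ())

  star-codeg≥1 : ∀ x y → x ≢ y → 1 ≤ codeg (star (2 + m)) x y
  star-codeg≥1 zero y 0≢y with other-than-zero-and y
  ... | z , z≢0 , z≢y =
    Edge⇒1≤codeg {zero} {y} {z} (star-Edge (inj₁ refl) 0≢y (≢-sym z≢0) (≢-sym z≢y))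
  star-codeg≥1 (suc x) zero x≢0 with other-than-zero-and (suc x)
  ... | z , z≢0 , z≢x = Edge⇒1≤codeg {suc x} {zero} {z}
    (star-Edge (inj₂ (inj₁ refl)) x≢0 (≢-sym z≢x) (≢-sym z≢0))
  star-codeg≥1 (suc x) (suc y) x≢y =
    Edge⇒1≤codeg {suc x} {suc y} {zero} (star-Edge (inj₂ (inj₂ refl)) x≢y (λ ()) (λ ()))

  -- For z ≠ 0 the triple {1, 2, z} misses 0, so its indicator reduces to outside.
  star-codeg-1-2 : codeg (star (2 + m)) (# 1) (# 2) ≡ 1
  star-codeg-1-2 = subst (λ b → ∣ b ∷ tabulate {n = 2 + m} (λ _ → outside) ∣ ≡ 1)
    (sym (star-Edge {# 1} {# 2} {zero} (inj₂ (inj₂ refl)) (λ ()) (λ ()) (λ ())))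
    (cong suc (∣tabulate-outside∣≡0 (2 + m)))

star-extremal : ∀ {n} → 3 ≤ n → Σ (3Graph n) λ G → δ₂≡ G 1 × ¬ HasP₃Covering G
star-extremal {suc (suc (suc m))} (s≤s (s≤s (s≤s _))) =
  star (2 + m) ,
  (star-codeg≥1 {m} , # 1 , # 2 , (λ ()) , star-codeg-1-2 {m}) ,
  λ cover → star-P₃-free (proj₁ (cover zero))

theorem9 : ∀ (n : ℕ) → 8 ≤ n → c₂P₃≡ n 1
theorem9 n 8≤n =
  star-extremal (≤-trans (m≤m+n 3 5) 8≤n) , codeg-bound (≤-trans (n≤1+n 7) 8≤n)
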